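{- Let $G=(V,E)$ be a connected graph with maximum degree $\Delta\ge 2$, let $\mathcal{T}=(\mathcal{P},\mathcal{E})$ be a layering tree of $G$ with respect to a vertex $s$, and let $\ell\geq\ell(\mathcal{T})$. Let $P\in\mathcal{P}$ be a part of depth (layer) $k$, and let $i\geq k$. Then $|\mathrm{comp}(P)\cap L_{\leq i}|\leq \Delta^{\ell+i-k+2}$.
   Context: All graphs are simple, unweighted, undirected; $d_G$ is shortest-path distance. For a vertex $s$, the BFS layers are $L_i=\{v: d_G(s,v)=i\}$, $L_{\le j}=\bigcup_{i\le j}L_i$, $L_{\le -1}=\emptyset$. For each $i\ge 0$, let $S_i^1,\dots,S_i^{s_i}$ be the connected components of $G\setminus L_{\le i-1}$ and $P_i^j=S_i^j\cap L_i$; these nonempty sets are the parts at layer (depth) $i$, and $\mathcal{P}$ is the set of all parts. The layering tree $\mathcal{T}=(\mathcal{P},\mathcal{E})$ has the parts as vertices, with $P,P'$ adjacent iff some $u\in P$, $u'\in P'$ are adjacent in $G$; it is rooted at $\{s\}$. The length of $\mathcal{T}$ is $\ell(\mathcal{T})=\max_{P\in\mathcal{P}}\max_{u,v\in P} d_G(u,v)$. For a part $P$, $\mathrm{comp}(P)$ is the set of vertices of $G$ contained in $P$ or in some descendant part of $P$ in the rooted tree $\mathcal{T}$ (for $P$ at layer $k$, this is the connected component of $G\setminus L_{\le k-1}$ containing $P$). -}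

module Defs where

open import Data.Nat using (ℕ; zero; suc; _≤_; _<_)
open import Data.Fin using (Fin)
open import Data.Bool using (Bool; true; false)
open import Data.List using (List; length; filterᵇ; allFin)
open import Data.Product using (Σ; ∃; _×_)
open import Data.Unit using (⊤)
open import Relation.Binary.PropositionalEquality using (_≡_)
open import Relation.Nullary using (¬_)

record Graph : Set where
  field
    n      : ℕ
    adj    : Fin n → Fin n → Bool
    sym    : ∀ u v → adj u v ≡ adj v u
    irrefl : ∀ v → adj v v ≡ false
open Graph public

Vertex : Graph → Set
Vertex G = Fin (n G)

-- Walks of length m from u to v all of whose vertices satisfy `ok`
-- (i.e. walks in the induced subgraph on {w | ok w}).
data WalkIn (G : Graph) (ok : Vertex G → Set) : Vertex G → Vertex G → ℕ → Set where
  here : ∀ {u} → ok u → WalkIn G ok u u zero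
  step : ∀ {u w v m} → ok u → adj G u w ≡ true → WalkIn G ok w v m → WalkIn G ok u v (suc m)

Walk : (G : Graph) → Vertex G → Vertex G → ℕ → Set
Walk G = WalkIn G (λ _ → ⊤)

Connected : Graph → Set
Connected G = ∀ u v → ∃ λ m → Walk G u v m

Dist : (G : Graph) → Vertex G → Vertex G → ℕ → Set
Dist G u v m = Walk G u v m × (∀ j → j < m → ¬ Walk G u v j)

degree : (G : Graph) → Vertex G → ℕ
degree G v = length (filterᵇ (adj G v) (allFin (n G)))

MaxDegree : Graph → ℕ → Set
MaxDegree G Δ = (∀ v → degree G v ≤ Δ) × (∃ λ v → degree G v ≡ Δ)

InLayersUpTo : (G : Graph) → Vertex G → ℕ → Vertex G → Set
InLayersUpTo G s j v = ∃ λ i → i ≤ j × Dist G s v i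

-- v ∈ L_{≤ k-1}, with L_{≤ -1} = ∅.
InLayersBelow : (G : Graph) → Vertex G → ℕ → Vertex G → Set
InLayersBelow G s k v = ∃ λ i → i < k × Dist G s v i

SameCompOutside : (G : Graph) → Vertex G → ℕ → Vertex G → Vertex G → Set
SameCompOutside G s k u v = ∃ λ m → WalkIn G (λ w → ¬ InLayersBelow G s k w) u v m

-- u and v lie in the same part at layer k: both in L_k and in the same
-- component of G ∖ L_{≤ k-1}.
SamePart : (G : Graph) → Vertex G → ℕ → Vertex G → Vertex G → Set
SamePart G s k u v = Dist G s u k × Dist G s v k × SameCompOutside G s k u v

-- ℓ ≥ ℓ(𝒯): every two vertices of a common part are at distance ≤ ℓ.
LengthAtMost : (G : Graph) → Vertex G → ℕ → Set
LengthAtMost G s ℓ = ∀ k u v → SamePart G s k u v → ∀ d → Dist G u v d → d ≤ ℓ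

-- v ∈ comp(P), where P is the part at layer k containing p (Dist G s p k):
-- the component of G ∖ L_{≤ k-1} containing P.
InComp : (G : Graph) → Vertex G → ℕ → Vertex G → Vertex G → Set
InComp G s k p v = SameCompOutside G s k p v

-- A vertex v of comp(P) in layer j ≥ k has a geodesic from s whose vertex u in layer k,
-- together with the rest of the geodesic, avoids L_{≤ k-1}. So u lies in the part P itself,
-- and d(p, v) ≤ d(p, u) + (j - k) ≤ ℓ + (i - k) =: r. Thus comp(P) ∩ L_{≤ i} lies in the ball
-- of radius r around p, which has at most 1 + Δ + ⋯ + Δ^r ≤ Δ^(r+1) vertices as Δ ≥ 2.
module Submission where

open import Defs
open import Data.Nat using (ℕ; _≤_; _+_; _∸_; _^_)
open import Data.List using (List; length)
open import Data.List.Relation.Unary.All using (All)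
open import Data.List.Relation.Unary.Unique.Propositional using (Unique)
open import Data.Product using (_×_)

open import Data.Nat using (zero; suc; _<_; _*_; z≤n; s≤s)
open import Data.Nat.Properties
open import Data.Nat.Induction using (<-rec)
open import Data.Fin.Properties using (any?) renaming (_≟_ to _≟ᶠ_)
open import Data.Bool using (true) renaming (_≟_ to _≟ᵇ_)
open import Data.Bool.Properties using (T-≡)
open import Data.List using ([]; _∷_; [_]; _++_; concatMap; filterᵇ; allFin)
open import Data.List.Properties using (length-++; length-removeAt′)
open import Data.List.Membership.Propositional using (_∈_)
open import Data.List.Membership.Propositional.Properties
  using (∈-concat⁺′; ∈-map⁺; ∈-filter⁺; ∈-allFin; ∈-++⁺ˡ; ∈-++⁺ʳ)
open import Data.List.Relation.Binary.Subset.Propositional using (_⊆_)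
open import Data.List.Relation.Unary.Any using (here; there; _─_)
import Data.List.Relation.Unary.All as All
open import Data.List.Relation.Unary.AllPairs using (_∷_)
open import Data.Product using (∃; _,_; proj₁)
open import Data.Sum using (inj₁; inj₂)
open import Data.Unit using (tt)
open import Relation.Nullary using (¬_; Dec; yes; no; contradiction)
open import Relation.Nullary.Decidable using (_×-dec_; T?)
open import Relation.Unary using (Pred; Decidable)
open import Function using (_∘_)
open import Function.Bundles using (Equivalence)
open import Relation.Binary.PropositionalEquality as ≡ using (_≢_; refl; subst)

∈-─⁺ : ∀ {A : Set} {x z : A} {ys : List A} (x∈ys : x ∈ ys) → x ≢ z → z ∈ ys → z ∈ (ys ─ x∈ys)
∈-─⁺ (here refl) x≢z (here refl) = contradiction refl x≢z
∈-─⁺ (here _)    x≢z (there z∈ys) = z∈ys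
∈-─⁺ (there _)   x≢z (here z≡y)   = here z≡y
∈-─⁺ (there x∈ys) x≢z (there z∈ys) = there (∈-─⁺ x∈ys x≢z z∈ys)

Unique∧⊆⇒length≤ : ∀ {A : Set} {xs ys : List A} → Unique xs → xs ⊆ ys → length xs ≤ length ys
Unique∧⊆⇒length≤ {xs = []} _ _ = z≤n
Unique∧⊆⇒length≤ {xs = x ∷ xs} {ys} (x∉xs ∷ uniq) xs⊆ys =
  subst (suc (length xs) ≤_) (≡.sym (length-removeAt′ ys _))
    (s≤s (Unique∧⊆⇒length≤ uniq λ z∈xs →
      ∈-─⁺ x∈ys (All.lookup x∉xs z∈xs) (xs⊆ys (there z∈xs))))
  where x∈ys = xs⊆ys (here refl)

length-concatMap-≤ : ∀ {A B : Set} (f : A → List B) {b} → (∀ x → length (f x) ≤ b) →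
                     ∀ xs → length (concatMap f xs) ≤ length xs * b
length-concatMap-≤ f f≤b []       = z≤n
length-concatMap-≤ f f≤b (x ∷ xs) = begin
  length (f x ++ concatMap f xs)          ≡⟨ length-++ (f x) ⟩
  length (f x) + length (concatMap f xs)  ≤⟨ +-mono-≤ (f≤b x) (length-concatMap-≤ f f≤b xs) ⟩
  _ + length xs * _                       ∎
  where open ≤-Reasoning

Least : ∀ {p} → Pred ℕ p → Pred ℕ p
Least P d = P d × (∀ j → j < d → ¬ P j)

least : ∀ {p} {P : Pred ℕ p} → Decidable P → ∀ {m} → P m → ∃ (Least P)
least {P = P} P? {m} = <-rec (λ m → P m → ∃ (Least P)) search m
  where
  search : ∀ m → (∀ {j} → j < m → P j → ∃ (Least P)) → P m → ∃ (Least P)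
  search m rec Pm with anyUpTo? P? m
  ... | yes (j , j<m , Pj) = rec j<m Pj
  ... | no  none           = m , Pm , λ j j<m Pj → none (j , j<m , Pj)

module Walks (G : Graph) where

  infixr 5 _++ʷ_

  _++ʷ_ : ∀ {P a b c m k} → WalkIn G P a b m → WalkIn G P b c k → WalkIn G P a c (m + k)
  here _     ++ʷ w = w
  step o e r ++ʷ w = step o e (r ++ʷ w)

  source-ok : ∀ {P u v m} → WalkIn G P u v m → P u
  source-ok (here o)     = o
  source-ok (step o _ _) = o

  target-ok : ∀ {P u v m} → WalkIn G P u v m → P v
  target-ok (here o)     = o
  target-ok (step _ _ r) = target-ok r

  reverse : ∀ {P u v m} → WalkIn G P u v m → WalkIn G P v u m
  reverse (here o) = here o
  reverse {P} {u} {v} (step {w = w} {m = m} o e r) =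
    subst (WalkIn G P v u) (+-comm m 1)
      (reverse r ++ʷ step (source-ok r) (≡.trans (Graph.sym G w u) e) (here o))

  toWalk : ∀ {P u v m} → WalkIn G P u v m → Walk G u v m
  toWalk (here _)     = here tt
  toWalk (step _ e r) = step tt e (toWalk r)

  splitAt : ∀ a {b x v} → Walk G x v (a + b) → ∃ λ u → Walk G x u a × Walk G u v b
  splitAt zero    w            = _ , here tt , w
  splitAt (suc a) (step o e r) with u , w₁ , w₂ ← splitAt a r = u , step o e w₁ , w₂

  walk? : ∀ m x y → Dec (Walk G x y m)
  walk? zero x y with x ≟ᶠ y
  ... | yes refl = yes (here tt)
  ... | no  x≢y  = no λ { (here _) → x≢y refl }
  walk? (suc m) x y with any? (λ w → (adj G x w ≟ᵇ true) ×-dec walk? m w y)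
  ... | yes (w , e , r) = yes (step tt e r)
  ... | no  none        = no λ { (step _ e r) → none (_ , e , r) }

  shortest : ∀ {x y m} → Walk G x y m → ∃ (Dist G x y)
  shortest {x} {y} = least (λ m → walk? m x y)

  Dist⇒≤ : ∀ {x y d m} → Dist G x y d → Walk G x y m → d ≤ m
  Dist⇒≤ (_ , minimal) w = ≮⇒≥ λ m<d → minimal _ m<d w

  geodesic-prefix : ∀ {x u v a b} → Dist G x v (a + b) →
                    Walk G x u a → Walk G u v b → Dist G x u a
  geodesic-prefix {b = b} dv w₁ w₂ =
    w₁ , λ c c<a wc → <⇒≱ (+-monoˡ-< b c<a) (Dist⇒≤ dv (wc ++ʷ w₂))

module Layers (G : Graph) (s : Vertex G) where
  open Walks G

  NotBelow : ℕ → Vertex G → Set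
  NotBelow k w = ¬ InLayersBelow G s k w

  NotBelow⇒≤ : ∀ {k v j} → NotBelow k v → Dist G s v j → k ≤ j
  NotBelow⇒≤ v∉L<k dv = ≮⇒≥ λ j<k → v∉L<k (_ , j<k , dv)

  geodesic-start-notBelow : ∀ {k x v j m} → Dist G s v j → k + m ≤ j → Walk G x v m → NotBelow k x
  geodesic-start-notBelow {m = m} dv k+m≤j x⇝v (c , c<k , s⇝x , _) =
    <⇒≱ (<-≤-trans (+-monoˡ-< m c<k) k+m≤j) (Dist⇒≤ dv (s⇝x ++ʷ x⇝v))

  geodesic-suffix : ∀ {k x v j m} → Dist G s v j → k + m ≤ j → Walk G x v m →
                    WalkIn G (NotBelow k) x v m
  geodesic-suffix dv k+m≤j x⇝v@(here _) = here (geodesic-start-notBelow dv k+m≤j x⇝v)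
  geodesic-suffix {k} dv k+m≤j x⇝v@(step {m = m} _ e w⇝v) =
    step (geodesic-start-notBelow dv k+m≤j x⇝v) e
      (geodesic-suffix dv (≤-trans (+-monoʳ-≤ k (n≤1+n m)) k+m≤j) w⇝v)

  nearest-in-part : ∀ {k p v j} → Dist G s p k → InComp G s k p v → Dist G s v j →
                    ∃ λ u → SamePart G s k p u × Walk G u v (j ∸ k)
  nearest-in-part {k} dp (_ , p⇝v) dv
    with k+[j∸k]≡j ← m+[n∸m]≡n (NotBelow⇒≤ (target-ok p⇝v) dv)
    with dv′ ← subst (Dist G s _) (≡.sym k+[j∸k]≡j) dv
    with u , s⇝u , u⇝v ← splitAt k (proj₁ dv′)
    = u , (dp , geodesic-prefix dv′ s⇝u u⇝v , _ , p⇝u) , u⇝v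
    where p⇝u = p⇝v ++ʷ reverse (geodesic-suffix dv (≤-reflexive k+[j∸k]≡j) u⇝v)

  within-reach : ∀ {ℓ k p i v} → LengthAtMost G s ℓ → Dist G s p k →
                 InComp G s k p v → InLayersUpTo G s i v →
                 ∃ λ d → d ≤ ℓ + (i ∸ k) × Walk G p v d
  within-reach {k = k} {p} len≤ℓ dp v∈comp (j , j≤i , dv)
    with u , p~u@(_ , _ , _ , p⇝u) , u⇝v ← nearest-in-part dp v∈comp dv
    with d , dpu@(p⇝′u , _) ← shortest (toWalk p⇝u)
    = d + (j ∸ k) , +-mono-≤ (len≤ℓ k p u p~u d dpu) (∸-monoˡ-≤ k j≤i) , p⇝′u ++ʷ u⇝v

module Balls (G : Graph) where

  neighbours : Vertex G → List (Vertex G)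
  neighbours v = filterᵇ (adj G v) (allFin (n G))

  -- With multiplicity: one entry per walk of length j starting at v.
  walkEnds : Vertex G → ℕ → List (Vertex G)
  walkEnds v zero    = [ v ]
  walkEnds v (suc j) = concatMap (λ w → walkEnds w j) (neighbours v)

  ball : Vertex G → ℕ → List (Vertex G)
  ball v zero    = walkEnds v zero
  ball v (suc r) = walkEnds v (suc r) ++ ball v r

  ∈-walkEnds : ∀ {v u j} → Walk G v u j → u ∈ walkEnds v j
  ∈-walkEnds (here _) = here refl
  ∈-walkEnds {v} (step {w = w} {m = j} _ e w⇝u) =
    ∈-concat⁺′ (∈-walkEnds w⇝u) (∈-map⁺ (λ x → walkEnds x j) w∈neighbours)
    where
    w∈neighbours : w ∈ neighbours v
    w∈neighbours = ∈-filter⁺ (T? ∘ adj G v) (∈-allFin w) (Equivalence.from T-≡ e)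

  ∈-ball : ∀ {v u d} r → d ≤ r → Walk G v u d → u ∈ ball v r
  ∈-ball zero    z≤n    v⇝u = ∈-walkEnds v⇝u
  ∈-ball (suc r) d≤1+r v⇝u with m≤n⇒m<n∨m≡n d≤1+r
  ... | inj₁ (s≤s d≤r) = ∈-++⁺ʳ _ (∈-ball r d≤r v⇝u)
  ... | inj₂ refl      = ∈-++⁺ˡ (∈-walkEnds v⇝u)

  module _ {Δ} (deg≤Δ : ∀ v → degree G v ≤ Δ) where

    length-walkEnds : ∀ v j → length (walkEnds v j) ≤ Δ ^ j
    length-walkEnds v zero    = ≤-refl
    length-walkEnds v (suc j) = ≤-trans
      (length-concatMap-≤ (λ w → walkEnds w j) (λ w → length-walkEnds w j) (neighbours v))
      (*-monoˡ-≤ (Δ ^ j) (deg≤Δ v))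

    length-ball : 2 ≤ Δ → ∀ v r → length (ball v r) ≤ Δ ^ suc r
    length-ball 2≤Δ v zero    = *-monoˡ-≤ 1 (≤-trans (n≤1+n 1) 2≤Δ)
    length-ball 2≤Δ v (suc r) = begin
      length (walkEnds v (suc r) ++ ball v r)          ≡⟨ length-++ (walkEnds v (suc r)) ⟩
      length (walkEnds v (suc r)) + length (ball v r)  ≤⟨ +-mono-≤ (length-walkEnds v (suc r))
                                                                    (length-ball 2≤Δ v r) ⟩
      Δ ^ suc r + Δ ^ suc r                            ≡⟨ ≡.cong (Δ ^ suc r +_) (≡.sym (+-identityʳ _)) ⟩
      2 * Δ ^ suc r                                    ≤⟨ *-monoˡ-≤ (Δ ^ suc r) 2≤Δ ⟩
      Δ ^ suc (suc r)                                  ∎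
      where open ≤-Reasoning

lemma9 : (G : Graph) → Connected G → (Δ : ℕ) → MaxDegree G Δ → 2 ≤ Δ →
    (s : Vertex G) → (ℓ : ℕ) → LengthAtMost G s ℓ →
    (k : ℕ) → (p : Vertex G) → Dist G s p k →
    (i : ℕ) → k ≤ i →
    (xs : List (Vertex G)) → Unique xs →
    All (λ v → InComp G s k p v × InLayersUpTo G s i v) xs →
    length xs ≤ Δ ^ (ℓ + (i ∸ k) + 2)
lemma9 G _ Δ (deg≤Δ , _) 2≤Δ s ℓ len≤ℓ k p dp i _ xs uniq xs⊆comp∩L≤i = begin
  length xs          ≤⟨ Unique∧⊆⇒length≤ uniq (comp∩L≤i⊆ball ∘ All.lookup xs⊆comp∩L≤i) ⟩
  length (ball p r)  ≤⟨ length-ball deg≤Δ 2≤Δ p r ⟩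
  Δ ^ suc r          ≤⟨ <⇒≤ (^-monoʳ-< Δ 2≤Δ (n<1+n (suc r))) ⟩
  Δ ^ (2 + r)        ≡⟨ ≡.cong (Δ ^_) (+-comm 2 r) ⟩
  Δ ^ (r + 2)        ∎
  where
  open ≤-Reasoning
  open Balls G
  open Layers G s
  r = ℓ + (i ∸ k)
  comp∩L≤i⊆ball : ∀ {v} → InComp G s k p v × InLayersUpTo G s i v → v ∈ ball p r
  comp∩L≤i⊆ball (v∈comp , v∈L≤i) with _ , d≤r , p⇝v ← within-reach len≤ℓ dp v∈comp v∈L≤i
    = ∈-ball r d≤r p⇝v
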